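{- Let $\mathbf A$ be a Łukasiewicz near semiring. The ideal lattice $\langle \mathrm{Id}(\mathbf A),\cap,\vee,\{0\},A\rangle$ is isomorphic to the congruence lattice $\mathrm{Con}(\mathbf A)$ (via $I\mapsto\theta(I)$, where $a\,\theta(I)\,b$ iff $a^{\alpha}b,\,b^{\alpha}a\in I$). Consequently $\mathrm{Id}(\mathbf A)$ is an algebraic and distributive lattice.
   Context: An $\iota$-near semiring is an algebra $\langle A,+,\cdot,{}^{\alpha},0,1\rangle$ of type $\langle 2,2,1,0,0\rangle$ such that $\langle A,+\rangle$ is a join semilattice with least element $0$ and greatest element $1$ (order $x\le y$ iff $x+y=y$), $x\cdot1=x=1\cdot x$, $(x+y)\cdot z=xz+yz$, $x0=0x=0$, $(x^{\alpha})^{\alpha}=x$, and $x\le y$ implies $y^{\alpha}\le x^{\alpha}$. A Łukasiewicz near semiring is an $\iota$-near semiring satisfying $(x y^{\alpha})^{\alpha} y^{\alpha}=(y x^{\alpha})^{\alpha} x^{\alpha}$. Juxtaposition $xy$ denotes $x\cdot y$. An ideal of $\mathbf A$ is a set $I\subseteq A$ with $0\in I$ such that (I1) if $ab^{\alpha}\in I$ and $b\in I$ then $a\in I$; (I2) if $a^{\alpha}b\in I$ and $b^{\alpha}a\in I$ then $(ac)^{\alpha}(bc)\in I$ and $(ca)^{\alpha}(cb)\in I$ for every $c\in A$. $\mathrm{Id}(\mathbf A)$ is the set of ideals, ordered by inclusion, with $I\wedge J=I\cap J$ and $I\vee J=\langle I\cup J\rangle$, the least ideal containing $I\cup J$. 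-}

module Defs where

open import Level using (Level; 0ℓ) renaming (suc to lsuc)
open import Data.Product using (Σ; _×_; _,_; ∃)
open import Data.Sum using (_⊎_)
open import Data.Unit using (⊤)
open import Data.List using (List)
open import Data.List.Membership.Propositional using (_∈_)
open import Relation.Binary.PropositionalEquality using (_≡_)


record ŁukasiewiczNearSemiring : Set₁ where
  field
    Carrier : Set
    _+_     : Carrier → Carrier → Carrier
    _·_     : Carrier → Carrier → Carrier
    _ᵅ      : Carrier → Carrier
    𝟘       : Carrier
    𝟙       : Carrier

  infixl 6 _+_
  infixl 7 _·_
  infix 8 _ᵅ
  infix 4 _≤_

  _≤_ : Carrier → Carrier → Set
  x ≤ y = x + y ≡ y

  field
    +-assoc    : ∀ x y z → (x + y) + z ≡ x + (y + z)
    +-comm     : ∀ x y → x + y ≡ y + x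
    +-idem     : ∀ x → x + x ≡ x
    𝟘-least    : ∀ x → 𝟘 ≤ x
    𝟙-greatest : ∀ x → x ≤ 𝟙
    ·-identityʳ : ∀ x → x · 𝟙 ≡ x
    ·-identityˡ : ∀ x → 𝟙 · x ≡ x
    ·-distribʳ  : ∀ x y z → (x + y) · z ≡ x · z + y · z
    ·-zeroʳ     : ∀ x → x · 𝟘 ≡ 𝟘
    ·-zeroˡ     : ∀ x → 𝟘 · x ≡ 𝟘
    ᵅ-involutive : ∀ x → (x ᵅ) ᵅ ≡ x
    ᵅ-antitone   : ∀ {x y} → x ≤ y → y ᵅ ≤ x ᵅ
    łukasiewicz  : ∀ x y → (x · y ᵅ) ᵅ · y ᵅ ≡ (y · x ᵅ) ᵅ · x ᵅ

module Notions (𝐀 : ŁukasiewiczNearSemiring) where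
  open ŁukasiewiczNearSemiring 𝐀

  Subset : Set₁
  Subset = Carrier → Set

  Rel : Set₁
  Rel = Carrier → Carrier → Set

  infix 4 _⊆_ _≐_ _⊆₂_ _≐₂_
  _⊆_ : Subset → Subset → Set
  I ⊆ J = ∀ {x} → I x → J x

  _≐_ : Subset → Subset → Set
  I ≐ J = (I ⊆ J) × (J ⊆ I)

  _⊆₂_ : Rel → Rel → Set
  R ⊆₂ S = ∀ {x y} → R x y → S x y

  _≐₂_ : Rel → Rel → Set
  R ≐₂ S = (R ⊆₂ S) × (S ⊆₂ R)

  record IsIdeal (I : Subset) : Set where
    field
      zero∈ : I 𝟘
      I1    : ∀ {a b} → I (a · b ᵅ) → I b → I a
      I2ʳ   : ∀ {a b} → I (a ᵅ · b) → I (b ᵅ · a) → ∀ c → I ((a · c) ᵅ · (b · c))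
      I2ˡ   : ∀ {a b} → I (a ᵅ · b) → I (b ᵅ · a) → ∀ c → I ((c · a) ᵅ · (c · b))

  record IsCongruence (R : Rel) : Set where
    field
      refl′  : ∀ {x} → R x x
      sym′   : ∀ {x y} → R x y → R y x
      trans′ : ∀ {x y z} → R x y → R y z → R x z
      +-cong : ∀ {x x′ y y′} → R x x′ → R y y′ → R (x + y) (x′ + y′)
      ·-cong : ∀ {x x′ y y′} → R x x′ → R y y′ → R (x · y) (x′ · y′)
      ᵅ-cong : ∀ {x x′} → R x x′ → R (x ᵅ) (x′ ᵅ)

  data ⟨_⟩ (S : Subset) : Subset where
    base : ∀ {x} → S x → ⟨ S ⟩ x
    zero : ⟨ S ⟩ 𝟘
    i1   : ∀ {a b} → ⟨ S ⟩ (a · b ᵅ) → ⟨ S ⟩ b → ⟨ S ⟩ a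
    i2ʳ  : ∀ {a b} → ⟨ S ⟩ (a ᵅ · b) → ⟨ S ⟩ (b ᵅ · a) → ∀ c → ⟨ S ⟩ ((a · c) ᵅ · (b · c))
    i2ˡ  : ∀ {a b} → ⟨ S ⟩ (a ᵅ · b) → ⟨ S ⟩ (b ᵅ · a) → ∀ c → ⟨ S ⟩ ((c · a) ᵅ · (c · b))

  data Cg (R : Rel) : Rel where
    base   : ∀ {x y} → R x y → Cg R x y
    refl′  : ∀ {x} → Cg R x x
    sym′   : ∀ {x y} → Cg R x y → Cg R y x
    trans′ : ∀ {x y z} → Cg R x y → Cg R y z → Cg R x z
    +-cong : ∀ {x x′ y y′} → Cg R x x′ → Cg R y y′ → Cg R (x + y) (x′ + y′)
    ·-cong : ∀ {x x′ y y′} → Cg R x x′ → Cg R y y′ → Cg R (x · y) (x′ · y′)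
    ᵅ-cong : ∀ {x x′} → Cg R x x′ → Cg R (x ᵅ) (x′ ᵅ)

  infixr 7 _∩_
  infixr 6 _∨_
  _∩_ : Subset → Subset → Subset
  (I ∩ J) x = I x × J x

  _∨_ : Subset → Subset → Subset
  I ∨ J = ⟨ (λ x → I x ⊎ J x) ⟩

  ⋁ : {ι : Set} → (ι → Subset) → Subset
  ⋁ {ι} F = ⟨ (λ x → Σ ι (λ i → F i x)) ⟩

  ⦃0⦄ : Subset
  ⦃0⦄ x = x ≡ 𝟘

  Whole : Subset
  Whole _ = ⊤

  _∩₂_ : Rel → Rel → Rel
  (R ∩₂ S) x y = R x y × S x y

  _∨₂_ : Rel → Rel → Rel
  R ∨₂ S = Cg (λ x y → R x y ⊎ S x y)

  Δ : Rel
  Δ x y = x ≡ y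

  ∇ : Rel
  ∇ _ _ = ⊤

  θ : Subset → Rel
  θ I a b = I (a ᵅ · b) × I (b ᵅ · a)

  Compact : Subset → Set₁
  Compact K = ∀ {ι : Set} (F : ι → Subset) → (∀ i → IsIdeal (F i)) →
              K ⊆ ⋁ F →
              Σ (List ι) (λ is → K ⊆ ⋁ {Σ ι (λ i → i ∈ is)} (λ p → F (Data.Product.proj₁ p)))

-- The map I ↦ θ(I), where a θ(I) b iff aᵅb ∈ I and bᵅa ∈ I, is a lattice
-- isomorphism from Id(𝐀) onto Con(𝐀); its inverse sends a congruence R to
-- its kernel ker R = {x | x R 0}.
module Submission where

open import Defs
open import Data.Product using (Σ; _×_; _,_; proj₁; proj₂)
open import Data.Sum using (_⊎_; inj₁; inj₂)
open import Data.Unit using (tt)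
open import Data.List using (List; []; _∷_; _++_)
open import Data.List.Membership.Propositional using (_∈_)
open import Data.List.Membership.Propositional.Properties using (∈-++⁺ˡ; ∈-++⁺ʳ)
open import Data.List.Relation.Unary.Any using (here)
open import Relation.Binary.Construct.Closure.ReflexiveTransitive using (Star; ε; _◅_; _◅◅_; gmap; reverse)
open import Relation.Binary.PropositionalEquality

module Lemmas (𝐀 : ŁukasiewiczNearSemiring) where
  open ŁukasiewiczNearSemiring 𝐀
  open Notions 𝐀

  ≤-reflexive : ∀ {x y} → x ≡ y → x ≤ y
  ≤-reflexive {x} refl = +-idem x

  ≤-trans : ∀ {x y z} → x ≤ y → y ≤ z → x ≤ z
  ≤-trans {x} {y} {z} p q = begin
    x + z        ≡⟨ cong (x +_) (sym q) ⟩
    x + (y + z)  ≡⟨ sym (+-assoc x y z) ⟩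
    (x + y) + z  ≡⟨ cong (_+ z) p ⟩
    y + z        ≡⟨ q ⟩
    z            ∎
    where open ≡-Reasoning

  ≤-antisym : ∀ {x y} → x ≤ y → y ≤ x → x ≡ y
  ≤-antisym {x} {y} p q = trans (sym q) (trans (+-comm y x) p)

  x≤x+y : ∀ x y → x ≤ x + y
  x≤x+y x y = trans (sym (+-assoc x x y)) (cong (_+ y) (+-idem x))

  y≤x+y : ∀ x y → y ≤ x + y
  y≤x+y x y = subst (y ≤_) (+-comm y x) (x≤x+y y x)

  +-lub : ∀ {x y z} → x ≤ z → y ≤ z → x + y ≤ z
  +-lub {x} {y} {z} p q = trans (+-assoc x y z) (trans (cong (x +_) q) p)

  x+𝟘≡x : ∀ x → x + 𝟘 ≡ x
  x+𝟘≡x x = trans (+-comm x 𝟘) (𝟘-least x)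

  ≤𝟘⇒≡𝟘 : ∀ {x} → x ≤ 𝟘 → x ≡ 𝟘
  ≤𝟘⇒≡𝟘 {x} p = trans (sym (x+𝟘≡x x)) p

  ·-monoˡ : ∀ {x y} z → x ≤ y → x · z ≤ y · z
  ·-monoˡ {x} {y} z p = trans (sym (·-distribʳ x y z)) (cong (_· z) p)

  ·-decreasing : ∀ u y → u · y ≤ y
  ·-decreasing u y = subst (u · y ≤_) (·-identityˡ y) (·-monoˡ y (𝟙-greatest u))

  ᵅ-injective : ∀ {x y} → x ᵅ ≡ y ᵅ → x ≡ y
  ᵅ-injective {x} {y} p = trans (sym (ᵅ-involutive x)) (trans (cong _ᵅ p) (ᵅ-involutive y))

  ᵅ-reflects : ∀ {x y} → x ᵅ ≤ y ᵅ → y ≤ x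
  ᵅ-reflects {x} {y} p = subst₂ _≤_ (ᵅ-involutive y) (ᵅ-involutive x) (ᵅ-antitone p)

  𝟘ᵅ≡𝟙 : 𝟘 ᵅ ≡ 𝟙
  𝟘ᵅ≡𝟙 = ≤-antisym (𝟙-greatest (𝟘 ᵅ))
                    (ᵅ-reflects {𝟘 ᵅ} (≤-trans (≤-reflexive (ᵅ-involutive 𝟘)) (𝟘-least (𝟙 ᵅ))))

  𝟙ᵅ≡𝟘 : 𝟙 ᵅ ≡ 𝟘
  𝟙ᵅ≡𝟘 = ᵅ-injective (trans (ᵅ-involutive 𝟙) (sym 𝟘ᵅ≡𝟙))

  𝟘ᵅ·x≡x : ∀ x → 𝟘 ᵅ · x ≡ x
  𝟘ᵅ·x≡x x = trans (cong (_· x) 𝟘ᵅ≡𝟙) (·-identityˡ x)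

  -- the Łukasiewicz identity with y = 𝟙: every element annihilates its complement
  x·xᵅ≡𝟘 : ∀ x → x · x ᵅ ≡ 𝟘
  x·xᵅ≡𝟘 x = begin
    x · x ᵅ             ≡⟨ cong (_· x ᵅ) 𝟙xᵅᵅ≡x ⟨
    (𝟙 · x ᵅ) ᵅ · x ᵅ   ≡⟨ łukasiewicz x 𝟙 ⟨
    (x · 𝟙 ᵅ) ᵅ · 𝟙 ᵅ   ≡⟨ cong (λ t → (x · t) ᵅ · t) 𝟙ᵅ≡𝟘 ⟩
    (x · 𝟘) ᵅ · 𝟘       ≡⟨ ·-zeroʳ _ ⟩
    𝟘                   ∎
    where
    open ≡-Reasoning
    𝟙xᵅᵅ≡x : (𝟙 · x ᵅ) ᵅ ≡ x
    𝟙xᵅᵅ≡x = trans (cong _ᵅ (·-identityˡ (x ᵅ))) (ᵅ-involutive x)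

  xᵅ·x≡𝟘 : ∀ x → x ᵅ · x ≡ 𝟘
  xᵅ·x≡𝟘 x = trans (cong (x ᵅ ·_) (sym (ᵅ-involutive x))) (x·xᵅ≡𝟘 (x ᵅ))

  ≤⇒·ᵅ≡𝟘 : ∀ {x y} → x ≤ y → x · y ᵅ ≡ 𝟘
  ≤⇒·ᵅ≡𝟘 {x} {y} p = ≤𝟘⇒≡𝟘 (subst (x · y ᵅ ≤_) (x·xᵅ≡𝟘 y) (·-monoˡ (y ᵅ) p))

  ≤⇒ᵅ·≡𝟘 : ∀ {x y} → x ≤ y → y ᵅ · x ≡ 𝟘
  ≤⇒ᵅ·≡𝟘 {x} {y} p = trans (cong (y ᵅ ·_) (sym (ᵅ-involutive x))) (≤⇒·ᵅ≡𝟘 (ᵅ-antitone p))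

  ᵅ-+-glb : ∀ {m x y} → m ≤ x ᵅ → m ≤ y ᵅ → m ≤ (x + y) ᵅ
  ᵅ-+-glb {m} {x} {y} p q =
    subst (_≤ (x + y) ᵅ) (ᵅ-involutive m) (ᵅ-antitone (+-lub (transpose p) (transpose q)))
    where
    transpose : ∀ {z} → m ≤ z ᵅ → z ≤ m ᵅ
    transpose p = ᵅ-reflects (≤-trans (≤-reflexive (ᵅ-involutive m)) p)

  ᵅ-of-+ : ∀ x y → (x + y) ᵅ ≡ (x · y ᵅ) ᵅ · y ᵅ
  ᵅ-of-+ x y = ≤-antisym upper lower
    where
    m = (x · y ᵅ) ᵅ · y ᵅ
    lower : m ≤ (x + y) ᵅ
    -- by the Łukasiewicz identity m is also a multiple of xᵅ
    lower = ᵅ-+-glb (≤-trans (≤-reflexive (łukasiewicz x y)) (·-decreasing _ _)) (·-decreasing _ _)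
    unfold : (x + y) ᵅ ≡ ((x + y) · y ᵅ) ᵅ · y ᵅ
    unfold = begin
      (x + y) ᵅ                         ≡⟨ 𝟘ᵅ·x≡x _ ⟨
      𝟘 ᵅ · (x + y) ᵅ                   ≡⟨ cong (λ t → t ᵅ · (x + y) ᵅ) y·[x+y]ᵅ≡𝟘 ⟨
      (y · (x + y) ᵅ) ᵅ · (x + y) ᵅ     ≡⟨ łukasiewicz (x + y) y ⟨
      ((x + y) · y ᵅ) ᵅ · y ᵅ           ∎
      where
      open ≡-Reasoning
      y·[x+y]ᵅ≡𝟘 : y · (x + y) ᵅ ≡ 𝟘
      y·[x+y]ᵅ≡𝟘 = ≤⇒·ᵅ≡𝟘 (y≤x+y x y)
    upper : (x + y) ᵅ ≤ m
    upper = ≤-trans (≤-reflexive unfold) (·-monoˡ (y ᵅ) (ᵅ-antitone (·-monoˡ (y ᵅ) (x≤x+y x y))))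

  +-via-· : ∀ x y → x + y ≡ ((x · y ᵅ) ᵅ · y ᵅ) ᵅ
  +-via-· x y = ᵅ-injective (trans (ᵅ-of-+ x y) (sym (ᵅ-involutive _)))

  ·ᵅ≡𝟘⇒≤ : ∀ {x y} → x · y ᵅ ≡ 𝟘 → x ≤ y
  ·ᵅ≡𝟘⇒≤ {x} {y} p = ᵅ-injective (begin
    (x + y) ᵅ              ≡⟨ ᵅ-of-+ x y ⟩
    (x · y ᵅ) ᵅ · y ᵅ      ≡⟨ cong (λ t → t ᵅ · y ᵅ) p ⟩
    𝟘 ᵅ · y ᵅ              ≡⟨ 𝟘ᵅ·x≡x _ ⟩
    y ᵅ                    ∎)
    where open ≡-Reasoning

  ᵅ·≡𝟘⇒≤ : ∀ {x y} → y ᵅ · x ≡ 𝟘 → x ≤ y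
  ᵅ·≡𝟘⇒≤ {x} {y} p = ᵅ-reflects (·ᵅ≡𝟘⇒≤ (trans (cong (y ᵅ ·_) (ᵅ-involutive x)) p))

  infixr 7 _∧_
  _∧_ : Carrier → Carrier → Carrier
  x ∧ y = (x ᵅ + y ᵅ) ᵅ

  ∧≤ˡ : ∀ x y → x ∧ y ≤ x
  ∧≤ˡ x y = ᵅ-reflects (≤-trans (x≤x+y (x ᵅ) (y ᵅ)) (≤-reflexive (sym (ᵅ-involutive _))))

  ∧≤ʳ : ∀ x y → x ∧ y ≤ y
  ∧≤ʳ x y = ᵅ-reflects (≤-trans (y≤x+y (x ᵅ) (y ᵅ)) (≤-reflexive (sym (ᵅ-involutive _))))

  ∧-idem : ∀ x → x ∧ x ≡ x
  ∧-idem x = trans (cong _ᵅ (+-idem (x ᵅ))) (ᵅ-involutive x)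

  ∧-comm : ∀ x y → x ∧ y ≡ y ∧ x
  ∧-comm x y = cong _ᵅ (+-comm (x ᵅ) (y ᵅ))

  ∧-via-· : ∀ v u → v ∧ u ≡ (v ᵅ · u) ᵅ · u
  ∧-via-· v u = trans (ᵅ-of-+ (v ᵅ) (u ᵅ)) (cong (λ t → (v ᵅ · t) ᵅ · t) (ᵅ-involutive u))

  ⟨⟩-isIdeal : ∀ {S} → IsIdeal ⟨ S ⟩
  ⟨⟩-isIdeal = record { zero∈ = zero ; I1 = i1 ; I2ʳ = i2ʳ ; I2ˡ = i2ˡ }

  ⟨⟩-least : ∀ {S K} → IsIdeal K → S ⊆ K → ⟨ S ⟩ ⊆ K
  ⟨⟩-least iK s (base p) = s p
  ⟨⟩-least iK s zero = IsIdeal.zero∈ iK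
  ⟨⟩-least iK s (i1 p q) = IsIdeal.I1 iK (⟨⟩-least iK s p) (⟨⟩-least iK s q)
  ⟨⟩-least iK s (i2ʳ p q c) = IsIdeal.I2ʳ iK (⟨⟩-least iK s p) (⟨⟩-least iK s q) c
  ⟨⟩-least iK s (i2ˡ p q c) = IsIdeal.I2ˡ iK (⟨⟩-least iK s p) (⟨⟩-least iK s q) c

  Cg-isCongruence : ∀ {R} → IsCongruence (Cg R)
  Cg-isCongruence = record { refl′ = refl′ ; sym′ = sym′ ; trans′ = trans′
                           ; +-cong = +-cong ; ·-cong = ·-cong ; ᵅ-cong = ᵅ-cong }

  Cg-least : ∀ {R S} → IsCongruence S → R ⊆₂ S → Cg R ⊆₂ S
  Cg-least c s (base p) = s p
  Cg-least c s refl′ = IsCongruence.refl′ c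
  Cg-least c s (sym′ p) = IsCongruence.sym′ c (Cg-least c s p)
  Cg-least c s (trans′ p q) = IsCongruence.trans′ c (Cg-least c s p) (Cg-least c s q)
  Cg-least c s (+-cong p q) = IsCongruence.+-cong c (Cg-least c s p) (Cg-least c s q)
  Cg-least c s (·-cong p q) = IsCongruence.·-cong c (Cg-least c s p) (Cg-least c s q)
  Cg-least c s (ᵅ-cong p) = IsCongruence.ᵅ-cong c (Cg-least c s p)

  Cg-mono : ∀ {R S} → R ⊆₂ S → Cg R ⊆₂ Cg S
  Cg-mono s = Cg-least Cg-isCongruence (λ p → base (s p))

  module IdealCongruence {I : Subset} (iI : IsIdeal I) where
    open IsIdeal iI

    ≡𝟘∈ : ∀ {x} → x ≡ 𝟘 → I x
    ≡𝟘∈ p = subst I (sym p) zero∈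

    -- membership of xᵅy implies membership of y·xᵅ: apply I2 to w θ(I) y,
    -- where w = x ∧ y, and use w · xᵅ = 𝟘
    swap-∈ : ∀ {x y} → I (x ᵅ · y) → I (y · x ᵅ)
    swap-∈ {x} {y} h = subst I drop-left (I2ʳ w-θ-y₁ w-θ-y₂ (x ᵅ))
      where
      w = x ∧ y
      w-θ-y₁ : I (w ᵅ · y)
      w-θ-y₁ = subst I (sym (begin
        w ᵅ · y                   ≡⟨ cong (_· y) (ᵅ-involutive _) ⟩
        (x ᵅ + y ᵅ) · y           ≡⟨ ·-distribʳ (x ᵅ) (y ᵅ) y ⟩
        x ᵅ · y + y ᵅ · y         ≡⟨ cong (x ᵅ · y +_) (xᵅ·x≡𝟘 y) ⟩
        x ᵅ · y + 𝟘               ≡⟨ x+𝟘≡x _ ⟩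
        x ᵅ · y                   ∎)) h
        where open ≡-Reasoning
      w-θ-y₂ : I (y ᵅ · w)
      w-θ-y₂ = ≡𝟘∈ (≤⇒ᵅ·≡𝟘 (∧≤ʳ x y))
      drop-left : (w · x ᵅ) ᵅ · (y · x ᵅ) ≡ y · x ᵅ
      drop-left = trans (cong (λ t → t ᵅ · (y · x ᵅ)) (≤⇒·ᵅ≡𝟘 (∧≤ˡ x y))) (𝟘ᵅ·x≡x _)

    transport-∈ : ∀ {a b c} → I (a ᵅ · b) → θ I b c → I (a ᵅ · c)
    transport-∈ {a} p (q , r) = I1 (swap-∈ (I2ˡ q r (a ᵅ))) p

    θ-trans : ∀ {a b c} → θ I a b → θ I b c → θ I a c
    θ-trans (p , p′) (q , q′) = transport-∈ p (q , q′) , transport-∈ q′ (p′ , p)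

    θ-·ʳ : ∀ {a b} c → θ I a b → θ I (a · c) (b · c)
    θ-·ʳ c (p , q) = I2ʳ p q c , I2ʳ q p c

    θ-·ˡ : ∀ {a b} c → θ I a b → θ I (c · a) (c · b)
    θ-·ˡ c (p , q) = I2ˡ p q c , I2ˡ q p c

    θ-· : ∀ {a a′ b b′} → θ I a a′ → θ I b b′ → θ I (a · b) (a′ · b′)
    θ-· {a′ = a′} {b = b} p q = θ-trans (θ-·ʳ b p) (θ-·ˡ a′ q)

    -- a θ(I) b gives a·bᵅ ∈ I: multiply b θ(I) a on the right by bᵅ
    θ⇒·ᵅ∈ : ∀ {a b} → θ I a b → I (a · b ᵅ)
    θ⇒·ᵅ∈ {a} {b} (p , q) =
      subst I (trans (cong (λ t → t ᵅ · (a · b ᵅ)) (x·xᵅ≡𝟘 b)) (𝟘ᵅ·x≡x _)) (I2ʳ q p (b ᵅ))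

    θ-ᵅ : ∀ {a b} → θ I a b → θ I (a ᵅ) (b ᵅ)
    θ-ᵅ {a} {b} (p , q) = subst I (cong (_· b ᵅ) (sym (ᵅ-involutive a))) (θ⇒·ᵅ∈ (p , q))
                        , subst I (cong (_· a ᵅ) (sym (ᵅ-involutive b))) (θ⇒·ᵅ∈ (q , p))

    -- a + b = ((a · bᵅ)ᵅ · bᵅ)ᵅ is built from · and ᵅ
    θ-+ : ∀ {a a′ b b′} → θ I a a′ → θ I b b′ → θ I (a + b) (a′ + b′)
    θ-+ {a} {a′} {b} {b′} p q =
      subst₂ (θ I) (sym (+-via-· a b)) (sym (+-via-· a′ b′)) (θ-ᵅ (θ-· (θ-ᵅ (θ-· p (θ-ᵅ q))) (θ-ᵅ q)))

    θ-isCongruence : IsCongruence (θ I)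
    θ-isCongruence = record
      { refl′ = λ {x} → ≡𝟘∈ (xᵅ·x≡𝟘 x) , ≡𝟘∈ (xᵅ·x≡𝟘 x)
      ; sym′ = λ { (p , q) → q , p }
      ; trans′ = θ-trans
      ; +-cong = θ-+
      ; ·-cong = θ-·
      ; ᵅ-cong = θ-ᵅ
      }

    ∈⇒θ𝟘 : ∀ {x} → I x → θ I x 𝟘
    ∈⇒θ𝟘 {x} h = ≡𝟘∈ (·-zeroʳ _) , subst I (sym (𝟘ᵅ·x≡x x)) h

  open IdealCongruence public using (θ-isCongruence; ∈⇒θ𝟘)

  -- I is recovered from θ(I) as the class of 𝟘 (this needs no ideal axiom)
  θ𝟘⇒∈ : ∀ {I : Subset} {x} → θ I x 𝟘 → I x
  θ𝟘⇒∈ {I} {x} (_ , h) = subst I (𝟘ᵅ·x≡x x) h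

  θ-mono : ∀ {I J : Subset} → I ⊆ J → θ I ⊆₂ θ J
  θ-mono s (p , q) = s p , s q

  θ-reflects : ∀ {I J : Subset} → IsIdeal I → θ I ⊆₂ θ J → I ⊆ J
  θ-reflects {J = J} iI s h = θ𝟘⇒∈ {J} (s (∈⇒θ𝟘 iI h))

  ker : Rel → Subset
  ker R x = R x 𝟘

  module Kernel {R : Rel} (cR : IsCongruence R) where
    module R = IsCongruence cR

    ≡⇒R : ∀ {x y} → x ≡ y → R x y
    ≡⇒R {x} p = subst (R x) p R.refl′

    -- if vᵅu ∈ ker R then v ∧ u ≡ (vᵅu)ᵅu is R-related to 𝟘ᵅu = u
    meet-collapses : ∀ {v u} → R (v ᵅ · u) 𝟘 → R (v ∧ u) u
    meet-collapses {v} {u} h =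
      R.trans′ (≡⇒R (∧-via-· v u)) (R.trans′ (R.·-cong (R.ᵅ-cong h) R.refl′) (≡⇒R (𝟘ᵅ·x≡x u)))

    θ-ker⇒R : ∀ {a b} → R (a ᵅ · b) 𝟘 → R (b ᵅ · a) 𝟘 → R a b
    -- a R (b ∧ a) = (a ∧ b) R b
    θ-ker⇒R {a} {b} p q =
      R.trans′ (R.sym′ (meet-collapses q)) (R.trans′ (≡⇒R (∧-comm b a)) (meet-collapses p))

    R⇒θ-ker : ∀ {a b} → R a b → R (a ᵅ · b) 𝟘
    R⇒θ-ker {b = b} r = R.trans′ (R.·-cong (R.ᵅ-cong r) R.refl′) (≡⇒R (xᵅ·x≡𝟘 b))

    ker-isIdeal : IsIdeal (ker R)
    ker-isIdeal = record
      { zero∈ = R.refl′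
      -- a = a · 𝟘ᵅ R a · bᵅ R 𝟘
      ; I1 = λ p q → R.trans′ (R.trans′ (≡⇒R a≡a·𝟘ᵅ) (R.·-cong R.refl′ (R.ᵅ-cong (R.sym′ q)))) p
      ; I2ʳ = λ p q c → R⇒θ-ker (R.·-cong (θ-ker⇒R p q) R.refl′)
      ; I2ˡ = λ p q c → R⇒θ-ker (R.·-cong R.refl′ (θ-ker⇒R p q))
      }
      where
      a≡a·𝟘ᵅ : ∀ {a} → a ≡ a · 𝟘 ᵅ
      a≡a·𝟘ᵅ {a} = sym (trans (cong (a ·_) 𝟘ᵅ≡𝟙) (·-identityʳ a))

    θ-ker : θ (ker R) ≐₂ R
    θ-ker = (λ (p , q) → θ-ker⇒R p q) , (λ r → R⇒θ-ker r , R⇒θ-ker (R.sym′ r))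

  open Kernel public using (ker-isIdeal; θ-ker)

  θ-∩ : ∀ {I J} → θ (I ∩ J) ≐₂ (θ I ∩₂ θ J)
  θ-∩ = (λ ((p , p′) , (q , q′)) → (p , q) , (p′ , q′))
      , (λ ((p , q) , (p′ , q′)) → (p , p′) , (q , q′))

  θ-∨⊇ : ∀ {I J} → (θ I ∨₂ θ J) ⊆₂ θ (I ∨ J)
  θ-∨⊇ {I} {J} = Cg-least (θ-isCongruence ⟨⟩-isIdeal)
    (λ { (inj₁ p) → θ-mono {I} {I ∨ J} (λ x → base (inj₁ x)) p
       ; (inj₂ p) → θ-mono {J} {I ∨ J} (λ x → base (inj₂ x)) p })

  -- for ideals, I ∨ J lies in the kernel of the congruence θ(I) ∨ θ(J)
  θ-∨⊆ : ∀ {I J} → IsIdeal I → IsIdeal J → θ (I ∨ J) ⊆₂ (θ I ∨₂ θ J)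
  θ-∨⊆ {I} {J} iI iJ p = proj₁ (θ-ker Cg-isCongruence) (θ-mono {I ∨ J} I∨J⊆ker p)
    where
    I∨J⊆ker : (I ∨ J) ⊆ ker (θ I ∨₂ θ J)
    I∨J⊆ker = ⟨⟩-least (ker-isIdeal Cg-isCongruence)
      (λ { (inj₁ x) → base (inj₁ (∈⇒θ𝟘 iI x)) ; (inj₂ x) → base (inj₂ (∈⇒θ𝟘 iJ x)) })

  θ-⦃0⦄ : θ ⦃0⦄ ≐₂ Δ
  θ-⦃0⦄ = (λ (p , q) → ≤-antisym (ᵅ·≡𝟘⇒≤ q) (ᵅ·≡𝟘⇒≤ p))
        , (λ { {a} refl → xᵅ·x≡𝟘 a , xᵅ·x≡𝟘 a })

  θ-Whole : θ Whole ≐₂ ∇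
  θ-Whole = (λ _ → tt) , (λ _ → tt , tt)

  -- M is a majority term: M a a b = a, M a b b = b and M a x a = a.

  M : Carrier → Carrier → Carrier → Carrier
  M a x b = (a ∧ x) + (x ∧ b) + (b ∧ a)

  absorb : ∀ {u a} → u ≤ a → a + u ≡ a
  absorb {u} {a} p = trans (+-comm a u) p

  M-aab : ∀ a b → M a a b ≡ a
  M-aab a b = trans (cong (λ t → t + (a ∧ b) + (b ∧ a)) (∧-idem a))
                (trans (cong (_+ (b ∧ a)) (absorb (∧≤ˡ a b))) (absorb (∧≤ʳ b a)))

  M-abb : ∀ a b → M a b b ≡ b
  M-abb a b = trans (cong (λ t → (a ∧ b) + t + (b ∧ a)) (∧-idem b))
                (trans (cong (_+ (b ∧ a)) (∧≤ʳ a b)) (absorb (∧≤ˡ b a)))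

  M-axa : ∀ a x → M a x a ≡ a
  M-axa a x = trans (cong ((a ∧ x) + (x ∧ a) +_) (∧-idem a)) (+-lub (∧≤ˡ a x) (∧≤ʳ x a))

  M-cong : ∀ {R} → IsCongruence R → ∀ {a a′ x x′ b b′} → R a a′ → R x x′ → R b b′ →
           R (M a x b) (M a′ x′ b′)
  M-cong {R} c p q r = C.+-cong (C.+-cong (∧-cong p q) (∧-cong q r)) (∧-cong r p)
    where
    module C = IsCongruence c
    ∧-cong : ∀ {x x′ y y′} → R x x′ → R y y′ → R (x ∧ y) (x′ ∧ y′)
    ∧-cong p q = C.ᵅ-cong (C.+-cong (C.ᵅ-cong p) (C.ᵅ-cong q))

  -- Con(𝐀) is distributive (Jónsson): if x α y and x (β ∨ γ) y, a chain of
  -- β- and γ-steps from x to y is mapped by M x – y to a chain of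
  -- (α∩β)- and (α∩γ)-steps from M x x y = x to M x y y = y.

  module CongruenceDistributivity {α β γ : Rel}
           (cα : IsCongruence α) (cβ : IsCongruence β) (cγ : IsCongruence γ) where

    module A = IsCongruence cα
    module B = IsCongruence cβ
    module G = IsCongruence cγ
    module C = IsCongruence

    U : Rel
    U u v = β u v ⊎ γ u v

    U-sym : ∀ {u v} → U u v → U v u
    U-sym (inj₁ p) = inj₁ (B.sym′ p)
    U-sym (inj₂ p) = inj₂ (G.sym′ p)

    chain-map : (f : Carrier → Carrier) → (∀ {R} → IsCongruence R → ∀ {u v} → R u v → R (f u) (f v)) →
                ∀ {x y} → Star U x y → Star U (f x) (f y)
    chain-map f h = gmap f λ { (inj₁ p) → inj₁ (h cβ p) ; (inj₂ p) → inj₂ (h cγ p) }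

    -- chains form a congruence, so β ∨ γ is the transitive closure of β ∪ γ
    chains-isCongruence : IsCongruence (Star U)
    chains-isCongruence = record
      { refl′ = ε
      ; sym′ = reverse U-sym
      ; trans′ = _◅◅_
      ; +-cong = λ {x} {x′} {y} p q →
          chain-map (_+ y) (λ c r → C.+-cong c r (C.refl′ c)) p
          ◅◅ chain-map (x′ +_) (λ c r → C.+-cong c (C.refl′ c) r) q
      ; ·-cong = λ {x} {x′} {y} p q →
          chain-map (_· y) (λ c r → C.·-cong c r (C.refl′ c)) p
          ◅◅ chain-map (x′ ·_) (λ c r → C.·-cong c (C.refl′ c) r) q
      ; ᵅ-cong = chain-map _ᵅ C.ᵅ-cong
      }

    join⇒chain : (β ∨₂ γ) ⊆₂ Star U
    join⇒chain = Cg-least chains-isCongruence (λ u → u ◅ ε)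

    D : Rel
    D = λ u v → (α ∩₂ β) u v ⊎ (α ∩₂ γ) u v

    M-α : ∀ {a b} x → α a b → α (M a x b) a
    M-α {a} x h = A.trans′ (M-cong cα A.refl′ A.refl′ (A.sym′ h)) (subst (α _) (M-axa a x) A.refl′)

    M-step : ∀ {a b x y} → α a b → U x y → D (M a x b) (M a y b)
    M-step {a} {b} {x} {y} h = tag
      where
      αxy : α (M a x b) (M a y b)
      αxy = A.trans′ (M-α x h) (A.sym′ (M-α y h))
      tag : U x y → D (M a x b) (M a y b)
      tag (inj₁ p) = inj₁ (αxy , M-cong cβ B.refl′ p B.refl′)
      tag (inj₂ p) = inj₂ (αxy , M-cong cγ G.refl′ p G.refl′)

    M-chain : ∀ {a b x y} → α a b → Star U x y → Cg D (M a x b) (M a y b)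
    M-chain h ε = refl′
    M-chain h (u ◅ us) = trans′ (base (M-step h u)) (M-chain h us)

    distributive : (α ∩₂ (β ∨₂ γ)) ⊆₂ ((α ∩₂ β) ∨₂ (α ∩₂ γ))
    distributive {x} {y} (h , c) = subst₂ (Cg D) (M-aab x y) (M-abb x y) (M-chain h (join⇒chain c))

  -- Id(𝐀) is distributive, transported from Con(𝐀) along θ.

  Id-distributive : ∀ {I J K} → IsIdeal I → IsIdeal J → IsIdeal K →
                    (I ∩ (J ∨ K)) ≐ ((I ∩ J) ∨ (I ∩ K))
  Id-distributive {I} {J} {K} iI iJ iK = to , from
    where
    open CongruenceDistributivity (θ-isCongruence iI) (θ-isCongruence iJ) (θ-isCongruence iK)
    to-θ : (I ∩ (J ∨ K)) ⊆ ker (θ I ∩₂ (θ J ∨₂ θ K))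
    to-θ (i , jk) = ∈⇒θ𝟘 iI i , θ-∨⊆ iJ iK (∈⇒θ𝟘 ⟨⟩-isIdeal jk)
    -- θ(I) ∩ θ(J) = θ(I ∩ J), and likewise for K
    from-θ : ((θ I ∩₂ θ J) ∨₂ (θ I ∩₂ θ K)) ⊆₂ θ ((I ∩ J) ∨ (I ∩ K))
    from-θ p = θ-∨⊇ {I ∩ J} {I ∩ K} (Cg-mono
      (λ { (inj₁ q) → inj₁ (proj₂ (θ-∩ {I} {J}) q) ; (inj₂ q) → inj₂ (proj₂ (θ-∩ {I} {K}) q) }) p)
    to : (I ∩ (J ∨ K)) ⊆ ((I ∩ J) ∨ (I ∩ K))
    to h = θ𝟘⇒∈ {(I ∩ J) ∨ (I ∩ K)} (from-θ (distributive (to-θ h)))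
    from : ((I ∩ J) ∨ (I ∩ K)) ⊆ (I ∩ (J ∨ K))
    from h = ⟨⟩-least iI (λ { (inj₁ (i , _)) → i ; (inj₂ (i , _)) → i }) h
           , ⟨⟩-least ⟨⟩-isIdeal (λ { (inj₁ (_ , j)) → base (inj₁ j) ; (inj₂ (_ , k)) → base (inj₂ k) }) h

  -- A derivation of y ∈ ⋁ F uses only finitely many members of the family.

  module FiniteSupport {ι : Set} (F : ι → Subset) where

    ⋁[_] : List ι → Subset
    ⋁[ L ] = ⋁ {Σ ι (λ i → i ∈ L)} (λ p → F (proj₁ p))

    support : ∀ {y} → ⋁ F y → List ι
    support (base (i , _)) = i ∷ []
    support zero = []
    support (i1 d e) = support d ++ support e
    support (i2ʳ d e c) = support d ++ support e
    support (i2ˡ d e c) = support d ++ support e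

    left : ∀ {y} (d : ⋁ F y) {ks L} → (∀ {i} → i ∈ support d ++ ks → i ∈ L) → ∀ {i} → i ∈ support d → i ∈ L
    left d s m = s (∈-++⁺ˡ m)

    right : ∀ {y} (d : ⋁ F y) {ks L} → (∀ {i} → i ∈ support d ++ ks → i ∈ L) → ∀ {i} → i ∈ ks → i ∈ L
    right d s m = s (∈-++⁺ʳ (support d) m)

    restrict : ∀ {y} (d : ⋁ F y) {L} → (∀ {i} → i ∈ support d → i ∈ L) → ⋁[ L ] y
    restrict (base (i , p)) s = base ((i , s (here refl)) , p)
    restrict zero s = zero
    restrict (i1 d e) s = i1 (restrict d (left d s)) (restrict e (right d s))
    restrict (i2ʳ d e c) s = i2ʳ (restrict d (left d s)) (restrict e (right d s)) c
    restrict (i2ˡ d e c) s = i2ˡ (restrict d (left d s)) (restrict e (right d s)) c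

  principal : Carrier → Subset
  principal x = ⟨ (λ y → y ≡ x) ⟩

  -- the principal ideal of x lies below the finite join over the support of x ∈ ⋁ F
  principal-compact : ∀ x → Compact (principal x)
  principal-compact x F _ x∈⋁F =
    support d , ⟨⟩-least ⟨⟩-isIdeal (λ { refl → restrict d (λ m → m) })
    where
    open FiniteSupport F
    d = x∈⋁F (base refl)

  -- every ideal is the union of the (compact) principal ideals it contains
  Id-algebraic : ∀ {I} → IsIdeal I → (U : Subset) → IsIdeal U →
                 ((K : Subset) → IsIdeal K → Compact K → K ⊆ I → K ⊆ U) → I ⊆ U
  Id-algebraic {I} iI U _ h {x} x∈I =
    h (principal x) ⟨⟩-isIdeal (principal-compact x)
      (⟨⟩-least iI (λ { refl → x∈I })) (base refl)

theorem3 : (𝐀 : ŁukasiewiczNearSemiring) → let open Notions 𝐀 in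
    ((I : Subset) → IsIdeal I → IsCongruence (θ I))
    × ((I J : Subset) → IsIdeal I → IsIdeal J → (I ⊆ J → θ I ⊆₂ θ J) × (θ I ⊆₂ θ J → I ⊆ J))
    × ((R : Rel) → IsCongruence R → Σ Subset (λ I → IsIdeal I × (θ I ≐₂ R)))
    × ((I J : Subset) → IsIdeal I → IsIdeal J → θ (I ∩ J) ≐₂ (θ I ∩₂ θ J))
    × ((I J : Subset) → IsIdeal I → IsIdeal J → θ (I ∨ J) ≐₂ (θ I ∨₂ θ J))
    × (θ ⦃0⦄ ≐₂ Δ)
    × (θ Whole ≐₂ ∇)
    × ((I J K : Subset) → IsIdeal I → IsIdeal J → IsIdeal K → (I ∩ (J ∨ K)) ≐ ((I ∩ J) ∨ (I ∩ K)))
    × ((I : Subset) → IsIdeal I → (U : Subset) → IsIdeal U →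
    ((K : Subset) → IsIdeal K → Compact K → K ⊆ I → K ⊆ U) → I ⊆ U)
theorem3 𝐀 =
    (λ I → θ-isCongruence)
  , (λ I J iI iJ → θ-mono , θ-reflects iI)
  , (λ R cR → ker R , ker-isIdeal cR , θ-ker cR)
  , (λ I J _ _ → θ-∩ {I} {J})
  , (λ I J iI iJ → θ-∨⊆ iI iJ , θ-∨⊇)
  , θ-⦃0⦄
  , θ-Whole
  , (λ I J K → Id-distributive)
  , (λ I → Id-algebraic)
  where open Lemmas 𝐀
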